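{- For every integer $n\ge 2$, let $H_n$ be the graph with vertex set $\{w,x_1,\dots,x_n,v,y,z,u\}$ whose edges are: the path edges $wx_1,\ x_1x_2,\ \dots,\ x_{n-1}x_n,\ x_nv$; the edges $yw$ and $yx_i$ for $i=1,\dots,n$; the edges $zv$ and $zx_i$ for $i=1,\dots,n$; and the edges $yz,\ uy,\ uz$. Then $H_n$ is a co-TT graph.
   Context: A graph $G=(V,E)$ is a threshold tolerance graph if each vertex $v$ can be assigned a positive weight $w_v$ and a positive tolerance $t_v$ such that for distinct $u,v$, $uv\in E$ iff $w_u+w_v>\min\{t_u,t_v\}$. A co-TT graph is the complement of a threshold tolerance graph. Equivalently (Monma–Reed–Trotter), $G$ is co-TT iff one can assign positive numbers $a_v,b_v$ to each vertex $v$ such that for distinct $x,y$: $xy\in E$ iff $a_x\le b_y$ and $a_y\le b_x$. -}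

module Defs where

open import Data.Nat using (ℕ; zero; suc)
open import Data.Fin using (Fin; toℕ)
open import Data.Rational using (ℚ; 0ℚ; _<_; _+_; _⊓_)
open import Data.Product using (Σ; _×_)
open import Data.Sum using (_⊎_)
open import Relation.Binary.PropositionalEquality using (_≡_; _≢_)
open import Relation.Nullary using (¬_)
open import Function.Bundles using (_⇔_)

IsTT : {V : Set} → (V → V → Set) → Set
IsTT {V} E =
  Σ (V → ℚ) λ w → Σ (V → ℚ) λ t →
    ((a : V) → 0ℚ < w a) × ((a : V) → 0ℚ < t a) ×
    ((a b : V) → a ≢ b → (E a b ⇔ (t a ⊓ t b < w a + w b)))

-- Complement graph (adjacency only matters for distinct vertices).
Complement : {V : Set} → (V → V → Set) → (V → V → Set)
Complement E a b = ¬ E a b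

IsCoTT : {V : Set} → (V → V → Set) → Set
IsCoTT E = IsTT (Complement E)

-- Vertices of H_n: w, x_1..x_n (x i is x_{toℕ i + 1}), v, y, z, u.
data HV (n : ℕ) : Set where
  w : HV n
  x : Fin n → HV n
  v : HV n
  y : HV n
  z : HV n
  u : HV n

data HEdge (n : ℕ) : HV n → HV n → Set where
  e-wx  : (i : Fin n) → toℕ i ≡ 0 → HEdge n w (x i)
  e-xx  : (i j : Fin n) → toℕ j ≡ suc (toℕ i) → HEdge n (x i) (x j)
  e-xv  : (i : Fin n) → suc (toℕ i) ≡ n → HEdge n (x i) v
  e-yw  : HEdge n y w
  e-yx  : (i : Fin n) → HEdge n y (x i)
  e-zv  : HEdge n z v
  e-zx  : (i : Fin n) → HEdge n z (x i)
  e-yz  : HEdge n y z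
  e-uy  : HEdge n u y
  e-uz  : HEdge n u z

HAdj : (n : ℕ) → HV n → HV n → Set
HAdj n a b = HEdge n a b ⊎ HEdge n b a

-- By Monma–Reed–Trotter it suffices to give each vertex a a pair lo a, hi a
-- such that distinct a, b are adjacent iff lo a ≤ hi b and lo b ≤ hi a; the
-- weight lo and tolerance lo + hi then exhibit the complement as a threshold
-- tolerance graph. For H_n, put the path w, x_1, …, x_n, v at positions
-- 0, …, n+1 and give the vertex at position p the pair (2p+1, 2p+3): two path
-- vertices then fit exactly when their positions differ by one. The remaining
-- vertices get y = (1, 2n+2), fitting positions 0..n; z = (4, 2n+3), fitting
-- positions 1..n+1; and u = (6, 4), fitting no path vertex. That u fits y and
-- z needs 2n+2 ≥ 6, which is where n ≥ 2 is used.
module Submission where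

open import Defs
open import Data.Nat using (ℕ; _≤_; zero; suc; _*_; _<_; z≤n; s≤s; s≤s⁻¹; _≤?_)
import Data.Nat.Properties as ℕ
open import Data.Integer using (+_; +≤+; +<+) renaming (_≤_ to _≤ℤ_; _<_ to _<ℤ_)
import Data.Integer.Properties as ℤ
open import Data.Rational using (ℚ; 0ℚ; _+_; _⊓_; *≤*; *<*) renaming (_≤_ to _≤ℚ_; _<_ to _<ℚ_)
open import Data.Rational.Literals using (fromℤ)
import Data.Rational.Properties as ℚ
open import Data.Fin using (toℕ)
open import Data.Fin.Properties using (toℕ<n; toℕ-injective)
open import Data.Product using (_×_; _,_; proj₁; proj₂)
import Data.Product as Product
open import Data.Product.Function.NonDependent.Propositional using (_×-⇔_)
open import Data.Sum using (_⊎_; inj₁; inj₂)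
import Data.Sum as Sum
open import Data.Empty using (⊥-elim)
open import Function using (_∘_)
open import Function.Bundles using (_⇔_; mk⇔)
open import Function.Properties.Equivalence using (trans; sym)
open import Function.Related.TypeIsomorphisms using (¬-cong-⇔)
open import Relation.Nullary using (¬_; yes; no)
open import Relation.Nullary.Decidable using (from-yes; from-no)
open import Relation.Binary using (tri<; tri≈; tri>)
open import Relation.Binary.PropositionalEquality using (_≡_; _≢_; refl; cong; subst; subst₂)
import Relation.Binary.PropositionalEquality as ≡

Overlap : {V C : Set} → (C → C → Set) → (V → C) → (V → C) → V → V → Set
Overlap _≼_ lo hi a b = lo a ≼ hi b × lo b ≼ hi a

¬overlap⇔tolerance<weight : (p q r s : ℚ) →
  (¬ (p ≤ℚ s × q ≤ℚ r)) ⇔ ((p + r) ⊓ (q + s) <ℚ p + q)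
¬overlap⇔tolerance<weight p q r s = mk⇔ to from
  where
  to : ¬ (p ≤ℚ s × q ≤ℚ r) → (p + r) ⊓ (q + s) <ℚ p + q
  to ¬o with q ℚ.≤? r
  ... | no q≰r = ℚ.≤-<-trans (ℚ.p⊓q≤p (p + r) (q + s)) (ℚ.+-monoʳ-< p (ℚ.≰⇒> q≰r))
  ... | yes q≤r = ℚ.≤-<-trans (ℚ.p⊓q≤q (p + r) (q + s))
    (subst (q + s <ℚ_) (ℚ.+-comm q p) (ℚ.+-monoʳ-< q (ℚ.≰⇒> (λ p≤s → ¬o (p≤s , q≤r)))))
  from : (p + r) ⊓ (q + s) <ℚ p + q → ¬ (p ≤ℚ s × q ≤ℚ r)
  from min<sum (p≤s , q≤r) = ℚ.<-irrefl refl (ℚ.<-≤-trans min<sum sum≤min)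
    where
    sum≤min : p + q ≤ℚ (p + r) ⊓ (q + s)
    sum≤min = ℚ.⊓-glb (ℚ.+-monoʳ-≤ p q≤r) (subst (_≤ℚ q + s) (ℚ.+-comm q p) (ℚ.+-monoʳ-≤ q p≤s))

IsCoTT-fromOverlap : {V : Set} {E : V → V → Set} (lo hi : V → ℚ) →
  (∀ a → 0ℚ <ℚ lo a) → (∀ a → 0ℚ ≤ℚ hi a) →
  (∀ a b → a ≢ b → E a b ⇔ Overlap _≤ℚ_ lo hi a b) → IsCoTT E
IsCoTT-fromOverlap lo hi lo>0 hi≥0 E⇔overlap =
  lo , (λ a → lo a + hi a) , lo>0 , (λ a → ℚ.+-mono-<-≤ (lo>0 a) (hi≥0 a)) ,
  λ a b a≢b → trans (¬-cong-⇔ (E⇔overlap a b a≢b)) (¬overlap⇔tolerance<weight (lo a) (lo b) (hi a) (hi b))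

fromℕ : ℕ → ℚ
fromℕ m = fromℤ (+ m)

fromℕ-mono-≤ : ∀ {m n} → m ≤ n → fromℕ m ≤ℚ fromℕ n
fromℕ-mono-≤ m≤n = *≤* (subst₂ _≤ℤ_ (≡.sym (ℤ.*-identityʳ _)) (≡.sym (ℤ.*-identityʳ _)) (+≤+ m≤n))

fromℕ-cancel-≤ : ∀ {m n} → fromℕ m ≤ℚ fromℕ n → m ≤ n
fromℕ-cancel-≤ (*≤* m≤n) = ℤ.drop‿+≤+ (subst₂ _≤ℤ_ (ℤ.*-identityʳ _) (ℤ.*-identityʳ _) m≤n)

fromℕ-mono-< : ∀ {m n} → m < n → fromℕ m <ℚ fromℕ n
fromℕ-mono-< m<n = *<* (subst₂ _<ℤ_ (≡.sym (ℤ.*-identityʳ _)) (≡.sym (ℤ.*-identityʳ _)) (+<+ m<n))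

IsCoTT-fromℕOverlap : {V : Set} {E : V → V → Set} (lo hi : V → ℕ) →
  (∀ a → 1 ≤ lo a) → (∀ a b → a ≢ b → E a b ⇔ Overlap _≤_ lo hi a b) → IsCoTT E
IsCoTT-fromℕOverlap lo hi lo≥1 E⇔overlap =
  IsCoTT-fromOverlap (fromℕ ∘ lo) (fromℕ ∘ hi) (fromℕ-mono-< ∘ lo≥1) (λ _ → fromℕ-mono-≤ z≤n)
    (λ a b a≢b → trans (E⇔overlap a b a≢b) (fromℕ-≤⇔ ×-⇔ fromℕ-≤⇔))
  where
  fromℕ-≤⇔ : ∀ {m n} → m ≤ n ⇔ fromℕ m ≤ℚ fromℕ n
  fromℕ-≤⇔ = mk⇔ fromℕ-mono-≤ fromℕ-cancel-≤

-- Written p * 2 so that odd (suc p) reduces to 2 + odd p.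
odd : ℕ → ℕ
odd p = suc (p * 2)

odd-mono-≤ : ∀ {p q} → p ≤ q → odd p ≤ odd q
odd-mono-≤ p≤q = s≤s (ℕ.*-monoˡ-≤ 2 p≤q)

odd-cancel-≤ : ∀ {p q} → odd p ≤ odd q → p ≤ q
odd-cancel-≤ {p} {q} h = ℕ.*-cancelʳ-≤ p q 2 (s≤s⁻¹ h)

within-one⇔consecutive : ∀ {m n} → m ≢ n → (m ≤ suc n × n ≤ suc m) ⇔ (n ≡ suc m ⊎ m ≡ suc n)
within-one⇔consecutive {m} {n} m≢n = mk⇔ to from
  where
  to : m ≤ suc n × n ≤ suc m → n ≡ suc m ⊎ m ≡ suc n
  to (m≤1+n , n≤1+m) with ℕ.<-cmp m n
  ... | tri< m<n _ _ = inj₁ (ℕ.≤-antisym n≤1+m m<n)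
  ... | tri≈ _ m≡n _ = ⊥-elim (m≢n m≡n)
  ... | tri> _ _ n<m = inj₂ (ℕ.≤-antisym m≤1+n n<m)
  from : n ≡ suc m ⊎ m ≡ suc n → m ≤ suc n × n ≤ suc m
  from (inj₁ refl) = ℕ.m≤n⇒m≤1+n (ℕ.n≤1+n m) , ℕ.≤-refl
  from (inj₂ refl) = ℕ.≤-refl , ℕ.m≤n⇒m≤1+n (ℕ.n≤1+n n)

module _ (n : ℕ) where

  lo : HV n → ℕ
  lo w = odd 0
  lo (x i) = odd (suc (toℕ i))
  lo v = odd (suc n)
  lo y = 1
  lo z = 4
  lo u = 6

  hi : HV n → ℕ
  hi w = odd 1
  hi (x i) = odd (suc (suc (toℕ i)))
  hi v = odd (suc (suc n))
  hi y = suc (odd n)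
  hi z = odd (suc n)
  hi u = 4

  Fits : HV n → HV n → Set
  Fits = Overlap _≤_ lo hi

  lo-positive : ∀ a → 1 ≤ lo a
  lo-positive w = s≤s z≤n
  lo-positive (x i) = s≤s z≤n
  lo-positive v = s≤s z≤n
  lo-positive y = s≤s z≤n
  lo-positive z = s≤s z≤n
  lo-positive u = s≤s z≤n

  edge : ∀ {a b} → HAdj n a b → Fits a b → HAdj n a b ⇔ Fits a b
  edge e f = mk⇔ (λ _ → f) (λ _ → e)

  non-edge : ∀ {a b} → ¬ HAdj n a b → ¬ Fits a b → HAdj n a b ⇔ Fits a b
  non-edge ¬e ¬f = mk⇔ (⊥-elim ∘ ¬e) (⊥-elim ∘ ¬f)

  mirror : ∀ {a b} → HAdj n b a ⇔ Fits b a → HAdj n a b ⇔ Fits a b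
  mirror e⇔f = trans (mk⇔ Sum.swap Sum.swap) (trans e⇔f (mk⇔ Product.swap Product.swap))

  w-x⇔ : ∀ i → HAdj n w (x i) ⇔ Fits w (x i)
  w-x⇔ i = mk⇔ to from
    where
    to : HAdj n w (x i) → Fits w (x i)
    to (inj₁ (e-wx _ i≡0)) = s≤s z≤n , odd-mono-≤ (s≤s (ℕ.≤-reflexive i≡0))
    from : Fits w (x i) → HAdj n w (x i)
    from (_ , h) = inj₁ (e-wx i (ℕ.n≤0⇒n≡0 (s≤s⁻¹ (odd-cancel-≤ h))))

  x-x⇔ : ∀ i j → x i ≢ x j → HAdj n (x i) (x j) ⇔ Fits (x i) (x j)
  x-x⇔ i j xi≢xj = trans adjacent⇔consecutive
    (trans (sym (within-one⇔consecutive (xi≢xj ∘ cong x ∘ toℕ-injective))) (odd-suc-≤⇔ ×-⇔ odd-suc-≤⇔))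
    where
    adjacent⇔consecutive : HAdj n (x i) (x j) ⇔ (toℕ j ≡ suc (toℕ i) ⊎ toℕ i ≡ suc (toℕ j))
    adjacent⇔consecutive = mk⇔ (Sum.map (λ { (e-xx _ _ e) → e }) (λ { (e-xx _ _ e) → e }))
                                (Sum.map (e-xx i j) (e-xx j i))
    odd-suc-≤⇔ : ∀ {p q} → p ≤ q ⇔ odd (suc p) ≤ odd (suc q)
    odd-suc-≤⇔ = mk⇔ (odd-mono-≤ ∘ s≤s) (s≤s⁻¹ ∘ odd-cancel-≤)

  x-v⇔ : ∀ i → HAdj n (x i) v ⇔ Fits (x i) v
  x-v⇔ i = mk⇔ to from
    where
    to : HAdj n (x i) v → Fits (x i) v
    to (inj₁ (e-xv _ 1+i≡n)) =
      odd-mono-≤ (ℕ.m≤n⇒m≤1+n (ℕ.m≤n⇒m≤1+n (toℕ<n i))) , odd-mono-≤ (s≤s (ℕ.≤-reflexive (≡.sym 1+i≡n)))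
    from : Fits (x i) v → HAdj n (x i) v
    from (_ , h) = inj₁ (e-xv i (ℕ.≤-antisym (toℕ<n i) (s≤s⁻¹ (odd-cancel-≤ h))))

  x-u-¬fits : ∀ i → ¬ Fits (x i) u
  x-u-¬fits i = no-odd-between (toℕ i)
    where
    no-odd-between : ∀ k → ¬ (odd (suc k) ≤ 4 × 6 ≤ odd (suc (suc k)))
    no-odd-between zero (_ , 6≤5) = ℕ.n≮n 5 6≤5
    no-odd-between (suc k) (4≥odd[2+k] , _) = ℕ.<⇒≱ (ℕ.m≤m+n 5 (k * 2)) 4≥odd[2+k]

  module _ (n≥2 : 2 ≤ n) where

    5≤odd-n : 5 ≤ odd n
    5≤odd-n = odd-mono-≤ n≥2

    6≤1+odd-n : 6 ≤ suc (odd n)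
    6≤1+odd-n = s≤s 5≤odd-n

    4<odd-1+n : 4 < odd (suc n)
    4<odd-1+n = ℕ.m≤n⇒m≤1+n (ℕ.m≤n⇒m≤1+n 5≤odd-n)

    4≤odd[2+p] : ∀ p → 4 ≤ odd (suc (suc p))
    4≤odd[2+p] p = ℕ.<⇒≤ (odd-mono-≤ {2} {suc (suc p)} (s≤s (s≤s z≤n)))

    adjacent⇔fits : ∀ a b → a ≢ b → HAdj n a b ⇔ Fits a b
    adjacent⇔fits w w w≢w = ⊥-elim (w≢w refl)
    adjacent⇔fits w (x i) _ = w-x⇔ i
    adjacent⇔fits w v _ = non-edge (λ { (inj₁ ()) ; (inj₂ ()) }) (ℕ.<⇒≱ (ℕ.<⇒≤ 4<odd-1+n) ∘ proj₂)
    adjacent⇔fits w y _ = edge (inj₂ e-yw) (s≤s z≤n , s≤s z≤n)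
    adjacent⇔fits w z _ = non-edge (λ { (inj₁ ()) ; (inj₂ ()) }) (from-no (4 ≤? 3) ∘ proj₂)
    adjacent⇔fits w u _ = non-edge (λ { (inj₁ ()) ; (inj₂ ()) }) (from-no (6 ≤? 3) ∘ proj₂)
    adjacent⇔fits (x i) w _ = mirror (adjacent⇔fits w (x i) λ ())
    adjacent⇔fits (x i) (x j) xi≢xj = x-x⇔ i j xi≢xj
    adjacent⇔fits (x i) v _ = x-v⇔ i
    adjacent⇔fits (x i) y _ = edge (inj₂ (e-yx i)) (ℕ.m≤n⇒m≤1+n (odd-mono-≤ (toℕ<n i)) , s≤s z≤n)
    adjacent⇔fits (x i) z _ = edge (inj₂ (e-zx i)) (odd-mono-≤ (ℕ.m≤n⇒m≤1+n (toℕ<n i)) , 4≤odd[2+p] (toℕ i))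
    adjacent⇔fits (x i) u _ = non-edge (λ { (inj₁ ()) ; (inj₂ ()) }) (x-u-¬fits i)
    adjacent⇔fits v w _ = mirror (adjacent⇔fits w v λ ())
    adjacent⇔fits v (x i) _ = mirror (adjacent⇔fits (x i) v λ ())
    adjacent⇔fits v v v≢v = ⊥-elim (v≢v refl)
    adjacent⇔fits v y _ = non-edge (λ { (inj₁ ()) ; (inj₂ ()) }) (ℕ.n≮n _ ∘ proj₁)
    adjacent⇔fits v z _ = edge (inj₂ e-zv) (ℕ.≤-refl , 4≤odd[2+p] n)
    adjacent⇔fits v u _ = non-edge (λ { (inj₁ ()) ; (inj₂ ()) }) (ℕ.<⇒≱ 4<odd-1+n ∘ proj₁)
    adjacent⇔fits y w _ = mirror (adjacent⇔fits w y λ ())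
    adjacent⇔fits y (x i) _ = mirror (adjacent⇔fits (x i) y λ ())
    adjacent⇔fits y v _ = mirror (adjacent⇔fits v y λ ())
    adjacent⇔fits y y y≢y = ⊥-elim (y≢y refl)
    adjacent⇔fits y z _ = edge (inj₁ e-yz) (s≤s z≤n , ℕ.≤-trans (from-yes (4 ≤? 6)) 6≤1+odd-n)
    adjacent⇔fits y u _ = edge (inj₂ e-uy) (s≤s z≤n , 6≤1+odd-n)
    adjacent⇔fits z w _ = mirror (adjacent⇔fits w z λ ())
    adjacent⇔fits z (x i) _ = mirror (adjacent⇔fits (x i) z λ ())
    adjacent⇔fits z v _ = mirror (adjacent⇔fits v z λ ())
    adjacent⇔fits z y _ = mirror (adjacent⇔fits y z λ ())
    adjacent⇔fits z z z≢z = ⊥-elim (z≢z refl)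
    adjacent⇔fits z u _ = edge (inj₂ e-uz) (ℕ.≤-refl , ℕ.m≤n⇒m≤1+n 6≤1+odd-n)
    adjacent⇔fits u w _ = mirror (adjacent⇔fits w u λ ())
    adjacent⇔fits u (x i) _ = mirror (adjacent⇔fits (x i) u λ ())
    adjacent⇔fits u v _ = mirror (adjacent⇔fits v u λ ())
    adjacent⇔fits u y _ = mirror (adjacent⇔fits y u λ ())
    adjacent⇔fits u z _ = mirror (adjacent⇔fits z u λ ())
    adjacent⇔fits u u u≢u = ⊥-elim (u≢u refl)

lemma17 : (n : ℕ) → 2 ≤ n → IsCoTT (HAdj n)
lemma17 n n≥2 = IsCoTT-fromℕOverlap (lo n) (hi n) (lo-positive n) (adjacent⇔fits n n≥2)
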